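{- Let $\mathbf{d}=(d_1,\dots,d_n)$ be a graphical sequence with $\sum_{i=1}^n d_i=4(n-1)-4$, $d_1<n-1$ and $d_n=2$. Then $\mathbf{d}$ admits a realization which is a $C_4$-pivotable graph.
   Context: A degree sequence is non-increasing, $d_1\ge\dots\ge d_n\ge 0$; it is graphical if some simple graph on $v_1,\dots,v_n$ has $\deg(v_i)=d_i$ (a realization). A simple graph $G$ on $n$ vertices with exactly $2n-4$ edges is $C_4$-pivotable if $G$ contains an induced cycle $C$ of length 4 and two spanning trees whose edge sets have exactly two common edges, both of which are edges of $C$. -}

module Defs where

open import Data.Nat using (ℕ; zero; suc; _+_; _*_; _∸_; _≤_; _<_)
open import Data.Fin using (Fin; toℕ)
open import Data.Bool using (Bool; true; false; if_then_else_)
open import Data.List using (List; []; _∷_; _++_; [_]; length; map; allFin; tabulate)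
open import Data.Nat.ListAction using (sum)
open import Data.List.Relation.Unary.Linked using (Linked)
open import Data.List.Relation.Unary.Unique.Propositional using (Unique)
open import Data.Product using (Σ; _×_; _,_; ∃; ∃-syntax)
open import Data.Sum using (_⊎_)
open import Relation.Binary.PropositionalEquality using (_≡_; _≢_)
open import Relation.Binary.Construct.Closure.ReflexiveTransitive using (Star)
open import Relation.Nullary using (¬_)
open import Function.Bundles using (_⇔_)

record Graph (n : ℕ) : Set where
  field
    adj   : Fin n → Fin n → Bool
    sym   : ∀ u v → adj u v ≡ adj v u
    irref : ∀ u → adj u u ≡ false
open Graph public

E : ∀ {n} → Graph n → Fin n → Fin n → Set
E G u v = adj G u v ≡ true

deg : ∀ {n} → Graph n → Fin n → ℕ
deg {n} G i = sum (map (λ j → if adj G i j then 1 else 0) (allFin n))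

edgeCount : ∀ {n} → Graph n → ℕ
edgeCount {n} G =
  sum (map (λ i → sum (map (λ j → if adj G i j then (if toℕ i Data.Nat.<ᵇ toℕ j then 1 else 0) else 0)
                           (allFin n)))
           (allFin n))

Σd : ∀ {n} → (Fin n → ℕ) → ℕ
Σd d = sum (tabulate d)

NonIncreasing : ∀ {n} → (Fin n → ℕ) → Set
NonIncreasing {n} d = ∀ (i j : Fin n) → toℕ i ≤ toℕ j → d j ≤ d i

Realization : ∀ {n} → (Fin n → ℕ) → Graph n → Set
Realization d G = ∀ i → deg G i ≡ d i

Graphical : ∀ {n} → (Fin n → ℕ) → Set
Graphical {n} d = NonIncreasing d × Σ (Graph n) (Realization d)

_⊆G_ : ∀ {n} → Graph n → Graph n → Set
T ⊆G G = ∀ u v → E T u v → E G u v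

Connected : ∀ {n} → Graph n → Set
Connected G = ∀ u v → Star (E G) u v

-- A cycle: distinct vertices v, v₁, …, vₖ (k ≥ 2, so length ≥ 3) with
-- consecutive vertices adjacent and vₖ adjacent to v.
Cycle : ∀ {n} → Graph n → Set
Cycle {n} G = Σ (Fin n) λ v → Σ (List (Fin n)) λ vs →
  (2 ≤ length vs) × Unique (v ∷ vs) × Linked (E G) (v ∷ vs ++ [ v ])

Acyclic : ∀ {n} → Graph n → Set
Acyclic G = ¬ Cycle G

SpanningTree : ∀ {n} → Graph n → Graph n → Set
SpanningTree G T = (T ⊆G G) × Connected T × Acyclic T

record InducedC4 {n} (G : Graph n) : Set where
  field
    a b c d : Fin n
    ab : a ≢ b
    ac : a ≢ c
    ad : a ≢ d
    bc : b ≢ c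
    bd : b ≢ d
    cd : c ≢ d
    eab : E G a b
    ebc : E G b c
    ecd : E G c d
    eda : E G d a
    nac : adj G a c ≡ false
    nbd : adj G b d ≡ false
open InducedC4 public

C4edge : ∀ {n} {G : Graph n} → InducedC4 G → Fin 4 → Fin n × Fin n
C4edge C Fin.zero = a C , b C
C4edge C (Fin.suc Fin.zero) = b C , c C
C4edge C (Fin.suc (Fin.suc Fin.zero)) = c C , d C
C4edge C (Fin.suc (Fin.suc (Fin.suc Fin.zero))) = d C , a C

SameEdge : ∀ {n} → Fin n → Fin n → Fin n × Fin n → Set
SameEdge u v (x , y) = (u ≡ x × v ≡ y) ⊎ (u ≡ y × v ≡ x)

C4Pivotable : ∀ {n} → Graph n → Set
C4Pivotable {n} G =
  (edgeCount G ≡ 2 * n ∸ 4) ×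
  Σ (InducedC4 G) λ C →
  Σ (Graph n) λ T₁ → Σ (Graph n) λ T₂ →
  SpanningTree G T₁ × SpanningTree G T₂ ×
  Σ (Fin 4) λ k₁ → Σ (Fin 4) λ k₂ → (k₁ ≢ k₂) ×
  (∀ u v → (E T₁ u v × E T₂ u v) ⇔ (SameEdge u v (C4edge C k₁) ⊎ SameEdge u v (C4edge C k₂)))

-- Induction on n ≥ 4. For n = 4 the sequence is (2,2,2,2), realized by the 4-cycle abcd, which
-- is pivotable via the two Hamiltonian paths d-a-b-c and a-b-c-d. For n > 4 remove a vertex p of
-- degree 2; the other degrees sum to 4(n-1) - 6. Choose x ≠ y of degree ≥ 3 (the two largest
-- degrees if another vertex of degree 2 remains, otherwise a vertex of degree 3 and the largest
-- other one) and lower their degrees by one: counting with the degree sum shows that this gives a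
-- sequence of the same kind on n - 1 vertices. Realize it inductively and put p back adjacent to
-- x and y; extending one spanning tree by the leaf edge px and the other by py keeps exactly the
-- same two common edges, and the induced 4-cycle survives.

module Submission where

open import Data.Bool using (Bool; true; false; if_then_else_; _∨_)
open import Data.Bool.Properties using (∨-zeroʳ)
open import Data.Empty using (⊥; ⊥-elim)
open import Data.Fin using (Fin; zero; suc; punchIn; toℕ; fromℕ)
open import Data.Fin.Patterns using (0F; 1F; 2F; 3F)
open import Data.Fin.Properties
  using (≤fromℕ; toℕ-injective; punchInᵢ≢i; punchIn-injective; punchIn-punchOut; any?)
  renaming (_≟_ to _≟ᶠ_)
open import Data.List using (List; []; _∷_; _++_; [_]; map; length; allFin)
import Data.List.Extrema.Nat as Extrema
open import Data.List.Membership.Propositional using (_∈_)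
open import Data.List.Membership.Propositional.Properties using (∈-∃++; ∈-allFin)
open import Data.List.Properties using (length-map; map-tabulate; length-++; ++-assoc; map-++)
open import Data.List.Relation.Unary.All using (All; []; _∷_; lookup)
import Data.List.Relation.Unary.All.Properties as All
open import Data.List.Relation.Unary.All.Properties.Core using (¬Any⇒All¬)
open import Data.List.Relation.Unary.AllPairs using ([]; _∷_)
open import Data.List.Relation.Unary.Any using (here; there)
import Data.List.Relation.Unary.Any as Any
open import Data.List.Relation.Unary.Linked using (Linked; [-]; _∷_)
import Data.List.Relation.Unary.Linked as Linked
import Data.List.Relation.Unary.Linked.Properties as Linked
open import Data.List.Relation.Unary.Unique.Propositional using (Unique)
import Data.List.Relation.Unary.Unique.Propositional.Properties as Unique
open import Data.Maybe using (Maybe; just; nothing)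
import Data.Maybe as Maybe
open import Data.Nat using (ℕ; zero; suc; _+_; _*_; _∸_; _≤_; _<_; _<ᵇ_; z≤n; s≤s; z<s; s≤s⁻¹; _≤?_)
import Data.Nat.ListAction as List
open import Data.Nat.Properties
  using ( _≟_; +-0-commutativeMonoid; suc-injective; +-comm; +-assoc; +-identityʳ; *-cancelˡ-≡
        ; ≤-refl; ≤-reflexive; ≤-trans; ≤-antisym; ≤∧≢⇒<; <⇒≱; ≰⇒>; m<m+n
        ; +-mono-≤; +-monoˡ-≤; ∸-monoˡ-≤; m+[n∸m]≡n; m∸n+n≡m
        ; module ≤-Reasoning)
open import Data.Nat.Tactic.RingSolver using (solve-∀)
open import Data.Product using (Σ; _×_; _,_; ∃; ∃₂; proj₁; proj₂)
import Data.Product as Product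
open import Data.Product.Function.NonDependent.Propositional using (_×-⇔_)
open import Data.Sum using (_⊎_; inj₁; inj₂)
import Data.Sum as Sum
open import Data.Sum.Function.Propositional using (_⊎-⇔_)
open import Function using (_∘_; case_of_)
open import Function.Bundles using (_⇔_; mk⇔)
open import Function.Properties.Equivalence using () renaming (trans to ⇔-trans; sym to ⇔-sym)
open import Relation.Binary.Construct.Closure.ReflexiveTransitive using (Star; ε; _◅_; _◅◅_; gmap; reverse)
open import Relation.Binary.PropositionalEquality hiding ([_])
open import Relation.Nullary using (¬_; yes; no; does)
open import Relation.Nullary.Decidable using (dec-true; dec-false)

open import Defs hiding (sym)
open import Algebra.Properties.CommutativeMonoid.Sum +-0-commutativeMonoid
  using (sum; sum-cong-≗; sum-remove; ∑-distrib-+; ∑-comm; sum-replicate-zero)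

≡⊎punchIn : ∀ {n} (p u : Fin (suc n)) → u ≡ p ⊎ ∃ λ i → u ≡ punchIn p i
≡⊎punchIn p u with u ≟ᶠ p
... | yes u≡p = inj₁ u≡p
... | no  u≢p = inj₂ (_ , sym (punchIn-punchOut (u≢p ∘ sym)))

avoiding⇒map-punchIn : ∀ {n} (p : Fin (suc n)) xs → All (p ≢_) xs → ∃ λ ws → map (punchIn p) ws ≡ xs
avoiding⇒map-punchIn p []       []         = [] , refl
avoiding⇒map-punchIn p (u ∷ xs) (p≢u ∷ ps) with ≡⊎punchIn p u | avoiding⇒map-punchIn p xs ps
... | inj₁ u≡p        | _        = ⊥-elim (p≢u (sym u≡p))
... | inj₂ (i , u≡pi) | ws , eq = i ∷ ws , cong₂ _∷_ (sym u≡pi) eq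

punchOut′ : ∀ {n} → Fin (suc n) → Fin (suc n) → Maybe (Fin n)
punchOut′         zero    zero    = nothing
punchOut′         zero    (suc i) = just i
punchOut′ {suc n} (suc p) zero    = just zero
punchOut′ {suc n} (suc p) (suc i) = Maybe.map suc (punchOut′ p i)

punchOut′-self : ∀ {n} (p : Fin (suc n)) → punchOut′ p p ≡ nothing
punchOut′-self         zero    = refl
punchOut′-self {suc n} (suc p) = cong (Maybe.map suc) (punchOut′-self p)

punchOut′-punchIn : ∀ {n} (p : Fin (suc n)) i → punchOut′ p (punchIn p i) ≡ just i
punchOut′-punchIn         zero    i       = refl
punchOut′-punchIn {suc n} (suc p) zero    = refl
punchOut′-punchIn {suc n} (suc p) (suc i) = cong (Maybe.map suc) (punchOut′-punchIn p i)

Σd≡sum : ∀ {n} (f : Fin n → ℕ) → Σd f ≡ sum f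
Σd≡sum {zero}  f = refl
Σd≡sum {suc n} f = cong (f zero +_) (Σd≡sum (f ∘ suc))

sum-mono-≤ : ∀ {n} {f g : Fin n → ℕ} → (∀ i → f i ≤ g i) → sum f ≤ sum g
sum-mono-≤ {zero}  f≤g = z≤n
sum-mono-≤ {suc n} f≤g = +-mono-≤ (f≤g zero) (sum-mono-≤ (f≤g ∘ suc))

sum-const : ∀ n c → sum {n} (λ _ → c) ≡ n * c
sum-const zero    c = refl
sum-const (suc n) c = cong (c +_) (sum-const n c)

sum-≥-with-distinct : ∀ {n} (f : Fin n → ℕ) {a b} xs → Unique xs →
  All (λ i → a ≤ f i) xs → (∀ i → b ≤ f i) → length xs * a + (n ∸ length xs) * b ≤ sum f
sum-≥-with-distinct {n} f {a} {b} [] _ _ b≤f = begin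
  n * b              ≡⟨ sum-const n b ⟨
  sum {n} (λ _ → b)  ≤⟨ sum-mono-≤ b≤f ⟩
  sum f              ∎
  where open ≤-Reasoning
sum-≥-with-distinct {suc n} f {a} {b} (x ∷ xs) (x∉xs ∷ uniq) (a≤fx ∷ a≤fxs) b≤f
  with avoiding⇒map-punchIn x xs x∉xs
... | ws , refl rewrite length-map (punchIn x) ws = begin
  a + length ws * a + (n ∸ length ws) * b     ≡⟨ +-assoc a _ _ ⟩
  a + (length ws * a + (n ∸ length ws) * b)   ≤⟨ +-mono-≤ a≤fx rest ⟩
  f x + sum (f ∘ punchIn x)                   ≡⟨ sum-remove f ⟨
  sum f                                       ∎
  where open ≤-Reasoning
        rest = sum-≥-with-distinct (f ∘ punchIn x) ws (Unique.map⁻ uniq) (All.map⁻ a≤fxs) (b≤f ∘ punchIn x)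

sum-≤-except : ∀ {n} (f : Fin (suc n) → ℕ) x {b} → (∀ i → i ≢ x → f i ≤ b) → sum f ≤ f x + n * b
sum-≤-except {n} f x {b} f≤b = begin
  sum f                       ≡⟨ sum-remove {i = x} f ⟩
  f x + sum (f ∘ punchIn x)   ≤⟨ +-mono-≤ ≤-refl (sum-mono-≤ (λ i → f≤b (punchIn x i) (punchInᵢ≢i x i))) ⟩
  f x + sum {n} (λ _ → b)     ≡⟨ cong (f x +_) (sum-const n b) ⟩
  f x + n * b                 ∎
  where open ≤-Reasoning

sum-map-allFin : ∀ {n} (f : Fin n → ℕ) → List.sum (map f (allFin n)) ≡ sum f
sum-map-allFin f = trans (cong List.sum (map-tabulate (λ i → i) f)) (Σd≡sum f)

𝟙 : Bool → ℕ
𝟙 b = if b then 1 else 0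

is : ∀ {n} → Fin n → Fin n → Bool
is x j = does (j ≟ᶠ x)

isEither : ∀ {n} → Fin n → Fin n → Fin n → Bool
isEither x y j = is x j ∨ is y j

is-true⇒≡ : ∀ {n} {x j : Fin n} → is x j ≡ true → j ≡ x
is-true⇒≡ {x = x} {j} h with j ≟ᶠ x
... | yes j≡x = j≡x

sum-𝟙-is : ∀ {n} (x : Fin (suc n)) → sum (𝟙 ∘ is x) ≡ 1
sum-𝟙-is {n} x = begin
  sum (𝟙 ∘ is x)                     ≡⟨ sum-remove {i = x} (𝟙 ∘ is x) ⟩
  𝟙 (is x x) + sum (𝟙 ∘ is x ∘ punchIn x)
    ≡⟨ cong₂ _+_ (cong 𝟙 (dec-true (x ≟ᶠ x) refl))
                 (sum-cong-≗ (λ i → cong 𝟙 (dec-false (punchIn x i ≟ᶠ x) (punchInᵢ≢i x i)))) ⟩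
  1 + sum {n} (λ _ → 0)              ≡⟨ cong suc (sum-replicate-zero n) ⟩
  1                                  ∎
  where open ≡-Reasoning

𝟙-isEither : ∀ {n} {x y : Fin n} → x ≢ y → ∀ j → 𝟙 (isEither x y j) ≡ 𝟙 (is x j) + 𝟙 (is y j)
𝟙-isEither {x = x} {y} x≢y j with j ≟ᶠ x | j ≟ᶠ y
... | yes refl | yes refl = ⊥-elim (x≢y refl)
... | yes _    | no  _    = refl
... | no  _    | yes _    = refl
... | no  _    | no  _    = refl

isEither-left : ∀ {n} (x y : Fin n) → isEither x y x ≡ true
isEither-left x y = cong (_∨ is y x) (dec-true (x ≟ᶠ x) refl)

isEither-right : ∀ {n} (x y : Fin n) → isEither x y y ≡ true
isEither-right x y = trans (cong (is x y ∨_) (dec-true (y ≟ᶠ y) refl)) (∨-zeroʳ (is x y))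

sum-𝟙-isEither : ∀ {n} {x y : Fin (suc n)} → x ≢ y → sum (𝟙 ∘ isEither x y) ≡ 2
sum-𝟙-isEither {x = x} {y} x≢y = begin
  sum (𝟙 ∘ isEither x y)                       ≡⟨ sum-cong-≗ (𝟙-isEither x≢y) ⟩
  sum (λ j → 𝟙 (is x j) + 𝟙 (is y j))          ≡⟨ ∑-distrib-+ (𝟙 ∘ is x) (𝟙 ∘ is y) ⟩
  sum (𝟙 ∘ is x) + sum (𝟙 ∘ is y)              ≡⟨ cong₂ _+_ (sum-𝟙-is x) (sum-𝟙-is y) ⟩
  2                                            ∎
  where open ≡-Reasoning

-- Degrees and the handshake lemma

deg≡sum : ∀ {n} (G : Graph n) i → deg G i ≡ sum (𝟙 ∘ adj G i)
deg≡sum G i = sum-map-allFin (𝟙 ∘ adj G i)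

forwardEdge : ∀ {n} → Graph n → Fin n → Fin n → ℕ
forwardEdge G i j = if adj G i j then 𝟙 (toℕ i <ᵇ toℕ j) else 0

𝟙-<ᵇ-exclusive : ∀ a b → a ≢ b → 𝟙 (a <ᵇ b) + 𝟙 (b <ᵇ a) ≡ 1
𝟙-<ᵇ-exclusive zero    zero    a≢b = ⊥-elim (a≢b refl)
𝟙-<ᵇ-exclusive zero    (suc b) _   = refl
𝟙-<ᵇ-exclusive (suc a) zero    _   = refl
𝟙-<ᵇ-exclusive (suc a) (suc b) a≢b = 𝟙-<ᵇ-exclusive a b (a≢b ∘ cong suc)

𝟙-adj≡forwardEdge : ∀ {n} (G : Graph n) i j → 𝟙 (adj G i j) ≡ forwardEdge G i j + forwardEdge G j i
𝟙-adj≡forwardEdge G i j rewrite Graph.sym G j i with adj G i j in eq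
... | false = refl
... | true  = sym (𝟙-<ᵇ-exclusive (toℕ i) (toℕ j) (i≢j ∘ toℕ-injective))
  where i≢j : i ≢ j
        i≢j refl = case trans (sym eq) (irref G i) of λ ()

edgeCount≡sum : ∀ {n} (G : Graph n) → edgeCount G ≡ sum (λ i → sum (forwardEdge G i))
edgeCount≡sum G = trans (sum-map-allFin (λ i → List.sum (map (forwardEdge G i) (allFin _))))
                        (sum-cong-≗ (λ i → sum-map-allFin (forwardEdge G i)))

handshake : ∀ {n} (G : Graph n) → sum (deg G) ≡ 2 * edgeCount G
handshake G = begin
  sum (deg G)
    ≡⟨ sum-cong-≗ (λ i → trans (deg≡sum G i) (sum-cong-≗ (𝟙-adj≡forwardEdge G i))) ⟩
  sum (λ i → sum (λ j → forwardEdge G i j + forwardEdge G j i))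
    ≡⟨ sum-cong-≗ (λ i → ∑-distrib-+ (forwardEdge G i) (λ j → forwardEdge G j i)) ⟩
  sum (λ i → sum (forwardEdge G i) + sum (λ j → forwardEdge G j i))
    ≡⟨ ∑-distrib-+ (λ i → sum (forwardEdge G i)) _ ⟩
  m + sum (λ i → sum (λ j → forwardEdge G j i))   ≡⟨ cong (m +_) (∑-comm (forwardEdge G)) ⟨
  m + m                                           ≡⟨ cong (m +_) (+-identityʳ m) ⟨
  2 * m                                           ≡⟨ cong (2 *_) (edgeCount≡sum G) ⟨
  2 * edgeCount G                                 ∎
  where open ≡-Reasoning
        m = sum (λ i → sum (forwardEdge G i))

-- Adding a vertex

module _ {n} (G : Graph n) (N : Fin n → Bool) where

  adjᴹ : Maybe (Fin n) → Maybe (Fin n) → Bool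
  adjᴹ nothing  nothing  = false
  adjᴹ nothing  (just j) = N j
  adjᴹ (just i) nothing  = N i
  adjᴹ (just i) (just j) = adj G i j

  adjᴹ-sym : ∀ u v → adjᴹ u v ≡ adjᴹ v u
  adjᴹ-sym nothing  nothing  = refl
  adjᴹ-sym nothing  (just j) = refl
  adjᴹ-sym (just i) nothing  = refl
  adjᴹ-sym (just i) (just j) = Graph.sym G i j

  adjᴹ-irrefl : ∀ u → adjᴹ u u ≡ false
  adjᴹ-irrefl nothing  = refl
  adjᴹ-irrefl (just i) = irref G i

-- The new vertex sits at position p and is joined to N; old vertex i becomes punchIn p i.
addVertex : ∀ {n} → Graph n → Fin (suc n) → (Fin n → Bool) → Graph (suc n)
addVertex G p N = record
  { adj   = λ u v → adjᴹ G N (punchOut′ p u) (punchOut′ p v)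
  ; sym   = λ u v → adjᴹ-sym G N (punchOut′ p u) (punchOut′ p v)
  ; irref = λ u → adjᴹ-irrefl G N (punchOut′ p u)
  }

module _ {n} (G : Graph n) (p : Fin (suc n)) (N : Fin n → Bool) where

  private G⁺ = addVertex G p N

  adj-addVertex-old : ∀ i j → adj G⁺ (punchIn p i) (punchIn p j) ≡ adj G i j
  adj-addVertex-old i j rewrite punchOut′-punchIn p i | punchOut′-punchIn p j = refl

  adj-addVertex-new : ∀ j → adj G⁺ p (punchIn p j) ≡ N j
  adj-addVertex-new j rewrite punchOut′-self p | punchOut′-punchIn p j = refl

  adj-addVertex-new′ : ∀ i → adj G⁺ (punchIn p i) p ≡ N i
  adj-addVertex-new′ i = trans (Graph.sym G⁺ (punchIn p i) p) (adj-addVertex-new i)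

  adj-addVertex-self : adj G⁺ p p ≡ false
  adj-addVertex-self = irref G⁺ p

  deg-addVertex-old : ∀ i → deg G⁺ (punchIn p i) ≡ 𝟙 (N i) + deg G i
  deg-addVertex-old i = begin
    deg G⁺ (punchIn p i)
      ≡⟨ deg≡sum G⁺ (punchIn p i) ⟩
    sum (𝟙 ∘ adj G⁺ (punchIn p i))
      ≡⟨ sum-remove {i = p} (𝟙 ∘ adj G⁺ (punchIn p i)) ⟩
    𝟙 (adj G⁺ (punchIn p i) p) + sum (𝟙 ∘ adj G⁺ (punchIn p i) ∘ punchIn p)
      ≡⟨ cong₂ _+_ (cong 𝟙 (adj-addVertex-new′ i)) (sum-cong-≗ (cong 𝟙 ∘ adj-addVertex-old i)) ⟩
    𝟙 (N i) + sum (𝟙 ∘ adj G i)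
      ≡⟨ cong (𝟙 (N i) +_) (deg≡sum G i) ⟨
    𝟙 (N i) + deg G i
      ∎
    where open ≡-Reasoning

  deg-addVertex-new : deg G⁺ p ≡ sum (𝟙 ∘ N)
  deg-addVertex-new = begin
    deg G⁺ p                                          ≡⟨ deg≡sum G⁺ p ⟩
    sum (𝟙 ∘ adj G⁺ p)                                ≡⟨ sum-remove {i = p} (𝟙 ∘ adj G⁺ p) ⟩
    𝟙 (adj G⁺ p p) + sum (𝟙 ∘ adj G⁺ p ∘ punchIn p)
      ≡⟨ cong₂ _+_ (cong 𝟙 adj-addVertex-self) (sum-cong-≗ (cong 𝟙 ∘ adj-addVertex-new)) ⟩
    sum (𝟙 ∘ N)                                       ∎
    where open ≡-Reasoning

Realization-addVertex : ∀ {n} {G : Graph n} {d′ : Fin n → ℕ} {d : Fin (suc n) → ℕ} p N →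
  Realization d′ G → d p ≡ sum (𝟙 ∘ N) → (∀ i → d (punchIn p i) ≡ 𝟙 (N i) + d′ i) →
  Realization d (addVertex G p N)
Realization-addVertex {G = G} p N real dp dpi v with ≡⊎punchIn p v
... | inj₁ refl       = trans (deg-addVertex-new G p N) (sym dp)
... | inj₂ (i , refl) = trans (deg-addVertex-old G p N i) (trans (cong (𝟙 (N i) +_) (real i)) (sym (dpi i)))

addVertex-⊆G : ∀ {n} {T G : Graph n} p {N M : Fin n → Bool} →
  T ⊆G G → (∀ j → N j ≡ true → M j ≡ true) → addVertex T p N ⊆G addVertex G p M
addVertex-⊆G p {N} {M} T⊆G N⊆M u v with punchOut′ p u | punchOut′ p v
... | nothing | nothing = λ ()
... | nothing | just j  = N⊆M j
... | just i  | nothing = N⊆M i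
... | just i  | just j  = T⊆G i j

-- Cycles and trees

module _ {X : Set} (R : X → X → Set) where

  IsCycle : X → List X → Set
  IsCycle v vs = (2 ≤ length vs) × Unique (v ∷ vs) × Linked R (v ∷ vs ++ [ v ])

  private
    Unique-rotate : ∀ {v : X} xs → Unique (v ∷ xs) → Unique (xs ++ [ v ])
    Unique-rotate []       _ = [] ∷ []
    Unique-rotate (a ∷ xs) ((v≢a ∷ v∉xs) ∷ (a∉xs ∷ uniq)) =
      All.++⁺ a∉xs ((v≢a ∘ sym) ∷ []) ∷ Unique-rotate xs (v∉xs ∷ uniq)

    Linked-snoc : ∀ xs {y z : X} → Linked R (xs ++ [ y ]) → R y z → Linked R (xs ++ y ∷ z ∷ [])
    Linked-snoc []            _            r = r ∷ [-]
    Linked-snoc (x ∷ [])      (r₀ ∷ [-])   r = r₀ ∷ r ∷ [-]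
    Linked-snoc (x ∷ x′ ∷ xs) (r₀ ∷ links) r = r₀ ∷ Linked-snoc (x′ ∷ xs) links r

  IsCycle-rotate : ∀ {v a : X} vs → IsCycle v (a ∷ vs) → IsCycle a (vs ++ [ v ])
  IsCycle-rotate {v} {a} vs (len , uniq , (r ∷ links)) = len′ , Unique-rotate (a ∷ vs) uniq , links′
    where
      len′ : 2 ≤ length (vs ++ [ v ])
      len′ rewrite length-++ vs {[ v ]} | +-comm (length vs) 1 = len
      links′ : Linked R (a ∷ (vs ++ [ v ]) ++ [ a ])
      links′ rewrite ++-assoc vs [ v ] [ a ] = Linked-snoc (a ∷ vs) links r

  IsCycle-rotateTo : ∀ {v w : X} {vs} → w ∈ v ∷ vs → IsCycle v vs → ∃ (IsCycle w)
  IsCycle-rotateTo (here refl) cyc = _ , cyc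
  IsCycle-rotateTo {vs = vs} (there w∈vs) cyc with ∈-∃++ w∈vs
  ... | pre , post , refl = go pre post cyc
    where
      go : ∀ pre {v w} post → IsCycle v (pre ++ w ∷ post) → ∃ (IsCycle w)
      go []        post cyc = _ , IsCycle-rotate post cyc
      go (a ∷ pre) {v} {w} post cyc with IsCycle-rotate (pre ++ w ∷ post) cyc
      ... | cyc′ rewrite ++-assoc pre (w ∷ post) [ v ] = go pre (post ++ [ v ]) cyc′

  private
    last-link : ∀ {w : X} b rest → Linked R (b ∷ rest ++ [ w ]) → ∃ λ u → u ∈ b ∷ rest × R u w
    last-link b []         (r ∷ [-])    = b , here refl , r
    last-link b (c ∷ rest) (_ ∷ links)  with last-link c rest links
    ... | u , u∈ , r = u , there u∈ , r

  IsCycle⇒two-neighbours : ∀ {v vs} → IsCycle v vs → ∃₂ λ u u′ → u ≢ u′ × R v u × R u′ v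
  IsCycle⇒two-neighbours {vs = _ ∷ []} (s≤s () , _)
  IsCycle⇒two-neighbours {vs = a ∷ b ∷ rest} (_ , (_ ∷ (a∉ ∷ _)) , (r ∷ (_ ∷ links)))
    with last-link b rest links
  ... | u , u∈ , r′ = a , u , (λ a≡u → lookup a∉ (subst (_∈ b ∷ rest) (sym a≡u) u∈) refl) , r , r′

  on-cycle⇒two-neighbours : ∀ {v w : X} vs → w ∈ v ∷ vs → IsCycle v vs → ∃₂ λ u u′ → u ≢ u′ × R w u × R u′ w
  on-cycle⇒two-neighbours vs w∈ cyc = IsCycle⇒two-neighbours (proj₂ (IsCycle-rotateTo w∈ cyc))

module _ {n} (T : Graph n) (p : Fin (suc n)) (x : Fin n) where

  private T⁺ = addVertex T p (is x)

  addLeaf-neighbour : ∀ u → E T⁺ p u → u ≡ punchIn p x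
  addLeaf-neighbour u e with ≡⊎punchIn p u
  ... | inj₁ refl = case trans (sym e) (adj-addVertex-self T p (is x)) of λ ()
  ... | inj₂ (i , refl) = cong (punchIn p) (is-true⇒≡ (trans (sym (adj-addVertex-new T p (is x) i)) e))

  addLeaf-connected : Connected T → Connected T⁺
  addLeaf-connected conn u v = to-x u ◅◅ reverse (λ {a} {b} e → trans (Graph.sym T⁺ b a) e) (to-x v)
    where
      to-x : ∀ u → Star (E T⁺) u (punchIn p x)
      to-x u with ≡⊎punchIn p u
      ... | inj₁ refl = trans (adj-addVertex-new T p (is x) x) (dec-true (x ≟ᶠ x) refl) ◅ ε
      ... | inj₂ (i , refl) =
        gmap (punchIn p) (λ {a} {b} e → trans (adj-addVertex-old T p (is x) a b) e) (conn i x)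

  addLeaf-acyclic : Acyclic T → Acyclic T⁺
  addLeaf-acyclic acyc (v , vs , cyc) with Any.any? (p ≟ᶠ_) (v ∷ vs)
  ... | yes p∈ with on-cycle⇒two-neighbours (E T⁺) vs p∈ cyc
  ...   | u , u′ , u≢u′ , e , e′ =
    u≢u′ (trans (addLeaf-neighbour u e) (sym (addLeaf-neighbour u′ (trans (Graph.sym T⁺ p u′) e′))))
  addLeaf-acyclic acyc (v , vs , cyc) | no p∉ with avoiding⇒map-punchIn p (v ∷ vs) (¬Any⇒All¬ _ p∉)
  ... | w ∷ ws , refl = acyc (w , ws , lower cyc)
    where
      lower : IsCycle (E T⁺) (punchIn p w) (map (punchIn p) ws) → IsCycle (E T) w ws
      lower (len , uniq , links) =
        subst (2 ≤_) (length-map (punchIn p) ws) len ,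
        Unique.map⁻ uniq ,
        Linked.map (λ {a} {b} e → trans (sym (adj-addVertex-old T p (is x) a b)) e)
                   (Linked.map⁻ (subst (Linked (E T⁺)) (cong (punchIn p w ∷_) (sym (map-++ (punchIn p) ws [ w ])))
                                       links))

addLeaf-spanningTree : ∀ {n} {G T : Graph n} p {M : Fin n → Bool} {x} → M x ≡ true →
  SpanningTree G T → SpanningTree (addVertex G p M) (addVertex T p (is x))
addLeaf-spanningTree {T = T} p {M} {x} Mx (T⊆G , conn , acyc) =
  addVertex-⊆G p T⊆G (λ j j≡x → subst (λ k → M k ≡ true) (sym (is-true⇒≡ j≡x)) Mx) ,
  addLeaf-connected T p x conn ,
  addLeaf-acyclic T p x acyc

C4PivotWitness : ∀ {n} → Graph n → Set
C4PivotWitness {n} G =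
  Σ (InducedC4 G) λ C →
  Σ (Graph n) λ T₁ → Σ (Graph n) λ T₂ →
  SpanningTree G T₁ × SpanningTree G T₂ ×
  Σ (Fin 4) λ k₁ → Σ (Fin 4) λ k₂ → (k₁ ≢ k₂) ×
  (∀ u v → (E T₁ u v × E T₂ u v) ⇔ (SameEdge u v (C4edge C k₁) ⊎ SameEdge u v (C4edge C k₂)))

module _ {n} (p : Fin (suc n)) where

  punchInPair : Fin n × Fin n → Fin (suc n) × Fin (suc n)
  punchInPair (a , b) = punchIn p a , punchIn p b

  SameEdge-punchIn : ∀ i j e → SameEdge (punchIn p i) (punchIn p j) (punchInPair e) ⇔ SameEdge i j e
  SameEdge-punchIn i j (_ , _) = mk⇔ (Sum.map (Product.map inj inj) (Product.map inj inj))
                               (Sum.map (Product.map (cong (punchIn p)) (cong (punchIn p)))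
                                        (Product.map (cong (punchIn p)) (cong (punchIn p))))
    where inj : ∀ {a b} → punchIn p a ≡ punchIn p b → a ≡ b
          inj = punchIn-injective p _ _

  ¬SameEdge-new : ∀ v e → ¬ SameEdge p v (punchInPair e)
  ¬SameEdge-new v (_ , _) (inj₁ (p≡ , _)) = punchInᵢ≢i p _ (sym p≡)
  ¬SameEdge-new v (_ , _) (inj₂ (p≡ , _)) = punchInᵢ≢i p _ (sym p≡)

  ¬SameEdge-new′ : ∀ u e → ¬ SameEdge u p (punchInPair e)
  ¬SameEdge-new′ u (_ , _) (inj₁ (_ , p≡)) = punchInᵢ≢i p _ (sym p≡)
  ¬SameEdge-new′ u (_ , _) (inj₂ (_ , p≡)) = punchInᵢ≢i p _ (sym p≡)

  InducedC4-addVertex : ∀ {G : Graph n} N → InducedC4 G → InducedC4 (addVertex G p N)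
  InducedC4-addVertex {G} N C = record
    { a = punchIn p (a C) ; b = punchIn p (b C) ; c = punchIn p (c C) ; d = punchIn p (d C)
    ; ab = ab C ∘ inj ; ac = ac C ∘ inj ; ad = ad C ∘ inj
    ; bc = bc C ∘ inj ; bd = bd C ∘ inj ; cd = cd C ∘ inj
    ; eab = lift (eab C) ; ebc = lift (ebc C) ; ecd = lift (ecd C) ; eda = lift (eda C)
    ; nac = lift (nac C) ; nbd = lift (nbd C)
    }
    where
      inj : ∀ {a b} → punchIn p a ≡ punchIn p b → a ≡ b
      inj = punchIn-injective p _ _
      lift : ∀ {i j β} → adj G i j ≡ β → adj (addVertex G p N) (punchIn p i) (punchIn p j) ≡ β
      lift = trans (adj-addVertex-old G p N _ _)

  C4edge-addVertex : ∀ {G : Graph n} N (C : InducedC4 G) k →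
    C4edge (InducedC4-addVertex N C) k ≡ punchInPair (C4edge C k)
  C4edge-addVertex N C zero                   = refl
  C4edge-addVertex N C (suc zero)             = refl
  C4edge-addVertex N C (suc (suc zero))       = refl
  C4edge-addVertex N C (suc (suc (suc zero))) = refl

module _ {n} {G : Graph n} (p : Fin (suc n)) {x y : Fin n} (x≢y : x ≢ y) where

  private
    N = isEither x y
    G⁺ = addVertex G p N

  C4PivotWitness-addVertex : C4PivotWitness G → C4PivotWitness G⁺
  C4PivotWitness-addVertex (C , T₁ , T₂ , tree₁ , tree₂ , k₁ , k₂ , k₁≢k₂ , common) =
    InducedC4-addVertex p N C , T₁⁺ , T₂⁺ ,
    addLeaf-spanningTree p (isEither-left x y) tree₁ , addLeaf-spanningTree p (isEither-right x y) tree₂ ,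
    k₁ , k₂ , k₁≢k₂ , common⁺
    where
      T₁⁺ = addVertex T₁ p (is x)
      T₂⁺ = addVertex T₂ p (is y)
      C⁺ = InducedC4-addVertex p N C

      no-common-edge-at-new : ∀ v → ¬ (E T₁⁺ p v × E T₂⁺ p v)
      no-common-edge-at-new v (e₁ , e₂) = x≢y (punchIn-injective p x y
        (trans (sym (addLeaf-neighbour T₁ p x v e₁)) (addLeaf-neighbour T₂ p y v e₂)))

      E-addVertex-old : ∀ {H : Graph n} M i j → E (addVertex H p M) (punchIn p i) (punchIn p j) ⇔ E H i j
      E-addVertex-old {H} M i j =
        mk⇔ (trans (sym (adj-addVertex-old H p M i j))) (trans (adj-addVertex-old H p M i j))

      common⁺ : ∀ u v → (E T₁⁺ u v × E T₂⁺ u v) ⇔ (SameEdge u v (C4edge C⁺ k₁) ⊎ SameEdge u v (C4edge C⁺ k₂))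
      common⁺ u v rewrite C4edge-addVertex p N C k₁ | C4edge-addVertex p N C k₂
        with ≡⊎punchIn p u | ≡⊎punchIn p v
      ... | inj₂ (i , refl) | inj₂ (j , refl) =
        ⇔-trans (E-addVertex-old (is x) i j ×-⇔ E-addVertex-old (is y) i j)
          (⇔-trans (common i j) (⇔-sym (SameEdge-punchIn p i j _ ⊎-⇔ SameEdge-punchIn p i j _)))
      ... | inj₁ refl | _ =
        mk⇔ (⊥-elim ∘ no-common-edge-at-new v) (⊥-elim ∘ Sum.[ ¬SameEdge-new p v _ , ¬SameEdge-new p v _ ])
      ... | inj₂ _ | inj₁ refl =
        mk⇔ (⊥-elim ∘ no-common-edge-at-new u
                    ∘ Product.map (trans (Graph.sym T₁⁺ p u)) (trans (Graph.sym T₂⁺ p u)))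
            (⊥-elim ∘ Sum.[ ¬SameEdge-new′ p u _ , ¬SameEdge-new′ p u _ ])

P₁ : Graph 1
P₁ = record { adj = λ _ _ → false ; sym = λ _ _ → refl ; irref = λ _ → refl }

P₁-spanningTree : SpanningTree P₁ P₁
P₁-spanningTree = (λ _ _ e → e) , (λ { 0F 0F → ε }) , λ { (0F , 0F ∷ _ , _ , (0≢0 ∷ _) ∷ _ , _) → 0≢0 refl }

P₃ : Graph 3
P₃ = addVertex (addVertex P₁ 1F (is 0F)) 2F (is 1F)

P₃-spanningTree : SpanningTree P₃ P₃
P₃-spanningTree = addLeaf-spanningTree 2F refl (addLeaf-spanningTree 1F refl P₁-spanningTree)

C₄ : Graph 4
C₄ = addVertex P₃ 3F (isEither 0F 2F)

C₄-deg : ∀ i → deg C₄ i ≡ 2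
C₄-deg 0F = refl
C₄-deg 1F = refl
C₄-deg 2F = refl
C₄-deg 3F = refl

-- The trees are the Hamiltonian paths 3-0-1-2 and 0-1-2-3, sharing the edges 01 and 12.
C₄-pivotWitness : C4PivotWitness C₄
C₄-pivotWitness =
  cycle , T₁ , T₂ ,
  addLeaf-spanningTree 3F refl P₃-spanningTree , addLeaf-spanningTree 3F refl P₃-spanningTree ,
  0F , 1F , (λ ()) , λ u v → mk⇔ (common u v) (common⁻¹ u v)
  where
    T₁ = addVertex P₃ 3F (is 0F)
    T₂ = addVertex P₃ 3F (is 2F)
    cycle : InducedC4 C₄
    cycle = record
      { a = 0F ; b = 1F ; c = 2F ; d = 3F
      ; ab = λ () ; ac = λ () ; ad = λ () ; bc = λ () ; bd = λ () ; cd = λ ()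
      ; eab = refl ; ebc = refl ; ecd = refl ; eda = refl ; nac = refl ; nbd = refl }
    common : ∀ u v → E T₁ u v × E T₂ u v → SameEdge u v (0F , 1F) ⊎ SameEdge u v (1F , 2F)
    common 0F 1F _ = inj₁ (inj₁ (refl , refl))
    common 1F 0F _ = inj₁ (inj₂ (refl , refl))
    common 1F 2F _ = inj₂ (inj₁ (refl , refl))
    common 2F 1F _ = inj₂ (inj₂ (refl , refl))
    common 0F 0F (() , _)
    common 0F 2F (() , _)
    common 0F 3F (_ , ())
    common 1F 1F (() , _)
    common 1F 3F (() , _)
    common 2F 0F (() , _)
    common 2F 2F (() , _)
    common 2F 3F (() , _)
    common 3F 0F (_ , ())
    common 3F 1F (() , _)
    common 3F 2F (() , _)
    common 3F 3F (() , _)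
    common⁻¹ : ∀ u v → SameEdge u v (0F , 1F) ⊎ SameEdge u v (1F , 2F) → E T₁ u v × E T₂ u v
    common⁻¹ _ _ (inj₁ (inj₁ (refl , refl))) = refl , refl
    common⁻¹ _ _ (inj₁ (inj₂ (refl , refl))) = refl , refl
    common⁻¹ _ _ (inj₂ (inj₁ (refl , refl))) = refl , refl
    common⁻¹ _ _ (inj₂ (inj₂ (refl , refl))) = refl , refl

-- Degree sequences

record Admissible k (d : Fin (4 + k) → ℕ) : Set where
  field
    lower : ∀ i → 2 ≤ d i
    upper : ∀ i → 2 + d i ≤ 4 + k
    total : sum d ≡ 8 + k * 4
    two   : Fin (4 + k)
    d-two : d two ≡ 2

argmax : ∀ {n} (f : Fin (suc n) → ℕ) → ∃ λ x → ∀ i → f i ≤ f x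
argmax f = Extrema.argmax f zero (allFin _) ,
           λ i → lookup (Extrema.f[xs]≤f[argmax] {f = f} zero (allFin _)) (∈-allFin i)

argmax-except : ∀ {n} (f : Fin (suc (suc n)) → ℕ) x → ∃ λ y → y ≢ x × ∀ z → z ≢ x → f z ≤ f y
argmax-except f x with argmax (f ∘ punchIn x)
... | y , max = punchIn x y , punchInᵢ≢i x y , λ z z≢x → case ≡⊎punchIn x z of λ where
  (inj₁ z≡x)        → ⊥-elim (z≢x z≡x)
  (inj₂ (i , refl)) → max i

m+suc[c]≡n⇒m<n : ∀ {m n} c → m + suc c ≡ n → m < n
m+suc[c]≡n⇒m<n {m} c eq = subst (m <_) eq (m<m+n m z<s)

-- e is an admissible sequence on 5 + k vertices with a vertex of degree 2 deleted. An attachment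
-- pair says where that vertex is put back: lowering e by one at x and y is again admissible.
module PairSelection {k} (e : Fin (4 + k) → ℕ)
  (e≥2 : ∀ i → 2 ≤ e i) (e<n : ∀ i → e i < 4 + k) (total : sum e ≡ 10 + k * 4) where

  record AttachmentPair : Set where
    field
      x y    : Fin (4 + k)
      x≢y    : x ≢ y
      ex≥3   : 3 ≤ e x
      ey≥3   : 3 ≤ e y
      others : ∀ z → z ≢ x → z ≢ y → 2 + e z ≤ 4 + k
      q      : Fin (4 + k)
      q-two  : e q ∸ 𝟙 (isEither x y q) ≡ 2

  private
    sum-≤ : ∀ {b} → sum e ≤ b → b < 10 + k * 4 → ⊥
    sum-≤ {b} ≤b b< = <⇒≱ b< (subst (_≤ b) total ≤b)

    sum-≥ : ∀ {b} → b ≤ sum e → 10 + k * 4 < b → ⊥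
    sum-≥ {b} b≤ <b = <⇒≱ <b (subst (b ≤_) total b≤)

    large : ∀ z → ¬ 2 + e z ≤ 4 + k → 3 + k ≤ e z
    large z ¬≤ = s≤s⁻¹ (s≤s⁻¹ (≰⇒> ¬≤))

    -- Bounds on Σ e excluding the configurations named, where 'large' means ≥ 3 + k.
    one-large-rest-two : (3 + k) + (3 + k) * 2 < 10 + k * 4
    one-large-rest-two = m+suc[c]≡n⇒m<n k (eq k)
      where eq : ∀ k → (3 + k) + (3 + k) * 2 + suc k ≡ 10 + k * 4
            eq = solve-∀

    three-large-rest-two : 10 + k * 4 < 3 * (3 + k) + (1 + k) * 2
    three-large-rest-two = m+suc[c]≡n⇒m<n k (eq k)
      where eq : ∀ k → 10 + k * 4 + suc k ≡ 3 * (3 + k) + (1 + k) * 2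
            eq = solve-∀

    all-four : 10 + k * 4 < (4 + k) * 4
    all-four = m+suc[c]≡n⇒m<n 5 (eq k)
      where eq : ∀ k → 10 + k * 4 + 6 ≡ (4 + k) * 4
            eq = solve-∀

    two-large-rest-three : 10 + k * 4 < 2 * (3 + k) + (2 + k) * 3
    two-large-rest-three = m+suc[c]≡n⇒m<n (suc k) (eq k)
      where eq : ∀ k → 10 + k * 4 + suc (suc k) ≡ 2 * (3 + k) + (2 + k) * 3
            eq = solve-∀

  attach-to-two-largest : ∀ q → e q ≡ 2 → ∀ x → (∀ i → e i ≤ e x) → ∀ y → y ≢ x → (∀ z → z ≢ x → e z ≤ e y) →
    AttachmentPair
  attach-to-two-largest q eq-two x x-max y y≢x y-max = record
    { x = x ; y = y ; x≢y = y≢x ∘ sym ; ex≥3 = ex≥3 ; ey≥3 = ey≥3 ; others = others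
    ; q = q ; q-two = q-two }
    where
      ey≥3 : 3 ≤ e y
      ey≥3 with 3 ≤? e y
      ... | yes ≥3 = ≥3
      ... | no  ≱3 = ⊥-elim (sum-≤ (begin
        sum e                 ≤⟨ sum-≤-except e x (λ i i≢x → ≤-trans (y-max i i≢x) (s≤s⁻¹ (≰⇒> ≱3))) ⟩
        e x + (3 + k) * 2     ≤⟨ +-monoˡ-≤ _ (s≤s⁻¹ (e<n x)) ⟩
        (3 + k) + (3 + k) * 2 ∎) one-large-rest-two)
        where open ≤-Reasoning

      ex≥3 : 3 ≤ e x
      ex≥3 = ≤-trans ey≥3 (x-max y)

      others : ∀ z → z ≢ x → z ≢ y → 2 + e z ≤ 4 + k
      others z z≢x z≢y with 2 + e z ≤? 4 + k
      ... | yes ≤n = ≤n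
      ... | no  ≰n = ⊥-elim (sum-≥
        (sum-≥-with-distinct e (x ∷ y ∷ z ∷ [])
          (((y≢x ∘ sym) ∷ (z≢x ∘ sym) ∷ []) ∷ ((z≢y ∘ sym) ∷ []) ∷ [] ∷ [])
          (≤-trans ey-large (x-max y) ∷ ey-large ∷ ez-large ∷ [])
          e≥2)
        three-large-rest-two)
        where ez-large = large z ≰n
              ey-large = ≤-trans ez-large (y-max z z≢x)

      q≢ : ∀ {v} → 3 ≤ e v → q ≢ v
      q≢ ev≥3 refl = <⇒≱ ev≥3 (≤-reflexive eq-two)

      q-two : e q ∸ 𝟙 (isEither x y q) ≡ 2
      q-two rewrite dec-false (q ≟ᶠ x) (q≢ ex≥3) | dec-false (q ≟ᶠ y) (q≢ ey≥3) = eq-two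

  with-degree-two : ∀ q → e q ≡ 2 → AttachmentPair
  with-degree-two q eq-two = case argmax e of λ where
    (x , x-max) → case argmax-except e x of λ where
      (y , y≢x , y-max) → attach-to-two-largest q eq-two x x-max y y≢x y-max

  -- Here x itself becomes the vertex of degree 2 required of the lowered sequence.
  attach-to-degree-three : (∀ i → 3 ≤ e i) → ∀ x → e x ≡ 3 → ∀ y → y ≢ x → (∀ z → z ≢ x → e z ≤ e y) →
    AttachmentPair
  attach-to-degree-three e≥3 x ex≡3 y y≢x y-max = record
    { x = x ; y = y ; x≢y = y≢x ∘ sym ; ex≥3 = e≥3 x ; ey≥3 = e≥3 y ; others = others
    ; q = x ; q-two = q-two }
    where
      others : ∀ z → z ≢ x → z ≢ y → 2 + e z ≤ 4 + k
      others z z≢x z≢y with 2 + e z ≤? 4 + k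
      ... | yes ≤n = ≤n
      ... | no  ≰n = ⊥-elim (sum-≥
        (sum-≥-with-distinct e (y ∷ z ∷ []) (((z≢y ∘ sym) ∷ []) ∷ [] ∷ [])
          (≤-trans ez-large (y-max z z≢x) ∷ ez-large ∷ []) e≥3)
        two-large-rest-three)
        where ez-large = large z ≰n

      q-two : e x ∸ 𝟙 (isEither x y x) ≡ 2
      q-two rewrite isEither-left x y | ex≡3 = refl

  e≥3-without-two : (∀ q → e q ≢ 2) → ∀ i → 3 ≤ e i
  e≥3-without-two no-two i = ≤∧≢⇒< (e≥2 i) (no-two i ∘ sym)

  without-degree-two : (∀ q → e q ≢ 2) → AttachmentPair
  without-degree-two no-two with any? (λ i → e i ≟ 3)
  ... | yes (x , ex≡3) = case argmax-except e x of λ where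
    (y , y≢x , y-max) → attach-to-degree-three (e≥3-without-two no-two) x ex≡3 y y≢x y-max
  ... | no no-three = ⊥-elim (sum-≥ (sum-≥-with-distinct e {a = 0} [] [] [] e≥4) all-four)
    where
      e≥4 : ∀ i → 4 ≤ e i
      e≥4 i = ≤∧≢⇒< (e≥3-without-two no-two i) (λ 3≡ei → no-three (i , sym 3≡ei))

  attachmentPair : AttachmentPair
  attachmentPair = case any? (λ i → e i ≟ 2) of λ where
    (yes (q , eq-two)) → with-degree-two q eq-two
    (no no-two)        → without-degree-two (λ q eq-two → no-two (q , eq-two))

  module _ (P : AttachmentPair) where
    open AttachmentPair P

    decrement : Fin (4 + k) → ℕ
    decrement i = e i ∸ 𝟙 (isEither x y i)

    e≡decrement+𝟙 : ∀ i → e i ≡ decrement i + 𝟙 (isEither x y i)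
    e≡decrement+𝟙 i = sym (m∸n+n≡m (≤-trans (𝟙≤1 (isEither x y i)) (≤-trans (s≤s z≤n) (e≥2 i))))
      where 𝟙≤1 : ∀ b → 𝟙 b ≤ 1
            𝟙≤1 true  = ≤-refl
            𝟙≤1 false = z≤n

    decrement-admissible : Admissible k decrement
    decrement-admissible = record
      { lower = lower ; upper = upper ; total = total⁻ ; two = q ; d-two = q-two }
      where
        lower : ∀ i → 2 ≤ decrement i
        lower i with i ≟ᶠ x | i ≟ᶠ y
        ... | yes refl | _        = ∸-monoˡ-≤ 1 ex≥3
        ... | no _     | yes refl = ∸-monoˡ-≤ 1 ey≥3
        ... | no _     | no _     = e≥2 i

        decrement-upper : ∀ i → 1 ≤ e i → 2 + (e i ∸ 1) ≤ 4 + k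
        decrement-upper i ei≥1 = subst (_≤ 4 + k) (cong suc (sym (m+[n∸m]≡n ei≥1))) (e<n i)

        upper : ∀ i → 2 + decrement i ≤ 4 + k
        upper i with i ≟ᶠ x | i ≟ᶠ y
        ... | yes refl | _        = decrement-upper x (≤-trans (s≤s z≤n) ex≥3)
        ... | no _     | yes refl = decrement-upper y (≤-trans (s≤s z≤n) ey≥3)
        ... | no i≢x   | no i≢y   = others i i≢x i≢y

        sum-e : sum e ≡ 2 + sum decrement
        sum-e = begin
          sum e                                              ≡⟨ sum-cong-≗ e≡decrement+𝟙 ⟩
          sum (λ i → decrement i + 𝟙 (isEither x y i))       ≡⟨ ∑-distrib-+ decrement (𝟙 ∘ isEither x y) ⟩
          sum decrement + sum (𝟙 ∘ isEither x y)             ≡⟨ cong (sum decrement +_) (sum-𝟙-isEither x≢y) ⟩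
          sum decrement + 2                                  ≡⟨ +-comm (sum decrement) 2 ⟩
          2 + sum decrement                                  ∎
          where open ≡-Reasoning

        total⁻ : sum decrement ≡ 8 + k * 4
        total⁻ = suc-injective (suc-injective (trans (sym sum-e) total))

realize-admissible : ∀ k (d : Fin (4 + k) → ℕ) → Admissible k d →
  Σ (Graph (4 + k)) λ G → Realization d G × C4PivotWitness G
realize-admissible zero d A = C₄ , (λ i → trans (C₄-deg i) (sym (all-two i))) , C₄-pivotWitness
  where
    open Admissible A
    all-two : ∀ i → d i ≡ 2
    all-two i = ≤-antisym (s≤s⁻¹ (s≤s⁻¹ (upper i))) (lower i)
realize-admissible (suc k) d A = addVertex G p N , realization , C4PivotWitness-addVertex p x≢y witness
  where
    open Admissible A
    p = two
    e = d ∘ punchIn p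

    -- 8 + suc k * 4 computes to 2 + (10 + k * 4)
    total-e : sum e ≡ 10 + k * 4
    total-e = suc-injective (suc-injective (begin
      2 + sum e             ≡⟨ cong (_+ sum e) d-two ⟨
      d p + sum e           ≡⟨ sum-remove d ⟨
      sum d                 ≡⟨ total ⟩
      8 + suc k * 4         ∎))
      where open ≡-Reasoning

    open PairSelection e (lower ∘ punchIn p) (s≤s⁻¹ ∘ upper ∘ punchIn p) total-e
    P = attachmentPair
    open AttachmentPair P
    N = isEither x y

    IH = realize-admissible k (decrement P) (decrement-admissible P)
    G = proj₁ IH
    real = proj₁ (proj₂ IH)
    witness = proj₂ (proj₂ IH)

    realization : Realization d (addVertex G p N)
    realization = Realization-addVertex p N real (trans d-two (sym (sum-𝟙-isEither x≢y)))
                    (λ i → trans (e≡decrement+𝟙 P i) (+-comm (decrement P i) (𝟙 (N i))))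

non-increasing-admissible : ∀ k (d : Fin (4 + k) → ℕ) → NonIncreasing d →
  sum d ≡ 8 + k * 4 → d zero < 3 + k → d (fromℕ (3 + k)) ≡ 2 → Admissible k d
non-increasing-admissible k d non-increasing total d₀<n-1 d-last = record
  { lower = λ i → subst (_≤ d i) d-last (non-increasing i (fromℕ (3 + k)) (≤fromℕ i))
  ; upper = λ i → s≤s (≤-trans (s≤s (non-increasing zero i z≤n)) d₀<n-1)
  ; total = total
  ; two   = fromℕ (3 + k)
  ; d-two = d-last
  }

edgeCount-from-degrees : ∀ k (G : Graph (4 + k)) {d} → Realization d G → sum d ≡ 8 + k * 4 →
  edgeCount G ≡ 2 * (4 + k) ∸ 4
edgeCount-from-degrees k G real total =
  *-cancelˡ-≡ _ _ 2 (trans (sym (handshake G)) (trans (sum-cong-≗ real) (trans total (sym (eq k)))))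
  where
    -- 2 * (2 * (4 + k) ∸ 4) in normal form: the ring solver cannot handle ∸.
    eq : ∀ k → 2 * (k + ((4 + k) + 0)) ≡ 8 + k * 4
    eq = solve-∀

d₀≥2 : ∀ {m} (d : Fin (suc m) → ℕ) → NonIncreasing d → d (fromℕ m) ≡ 2 → 2 ≤ d zero
d₀≥2 {m} d non-increasing d-last = subst (_≤ d zero) d-last (non-increasing zero (fromℕ m) z≤n)

lemma4p6 : (m : ℕ) → (d : Fin (suc m) → ℕ) →
    Graphical d →
    Σd d ≡ 4 * (suc m ∸ 1) ∸ 4 →
    d zero < suc m ∸ 1 →
    d (fromℕ m) ≡ 2 →
    Σ (Graph (suc m)) λ G → Realization d G × C4Pivotable G
-- For n ≤ 3 the chain 2 = d (fromℕ m) ≤ d zero < n - 1 is absurd.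
lemma4p6 0 d _ _ () _
lemma4p6 1 d (non-increasing , _) _ d₀<1 d-last =
  ⊥-elim (<⇒≱ d₀<1 (≤-trans (s≤s z≤n) (d₀≥2 d non-increasing d-last)))
lemma4p6 2 d (non-increasing , _) _ d₀<2 d-last =
  ⊥-elim (<⇒≱ d₀<2 (d₀≥2 d non-increasing d-last))
lemma4p6 (suc (suc (suc k))) d (non-increasing , _) Σd≡ d₀<n-1 d-last =
  G , real , edgeCount-from-degrees k G real total , witness
  where
    -- stated as 4 + _ so that ∸ 4 cancels by computation
    four-times : ∀ k → 4 * (3 + k) ≡ 4 + (8 + k * 4)
    four-times = solve-∀
    total : sum d ≡ 8 + k * 4
    total = trans (sym (Σd≡sum d)) (trans Σd≡ (cong (_∸ 4) (four-times k)))
    IH = realize-admissible k d (non-increasing-admissible k d non-increasing total d₀<n-1 d-last)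
    G = proj₁ IH
    real = proj₁ (proj₂ IH)
    witness = proj₂ (proj₂ IH)
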